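{- Let $G=(V,E)$ be a graph with $n$ vertices, $b$ an integer with $1\le b<n$, and $\pi:V\to\{1,\dots,n\}$ a bijection. Then $\pi$ is a $b$-ordering if and only if (a) for every edge $uv\in E$ with $\mathtt{segment}(\pi(u))+1=\mathtt{segment}(\pi(v))$, the position $\pi(u)$ comes later in the color order than $\pi(v)$, and (b) for every edge $uv\in E$, $|\mathtt{segment}(\pi(u))-\mathtt{segment}(\pi(v))|\le 1$.
   Context: A $b$-ordering is a bijection $\pi:V\to\{1,\dots,n\}$ with $|\pi(u)-\pi(v)|\le b$ for every edge $uv\in E$. For a position $i\in\{1,\dots,n\}$, $\mathtt{segment}(i)=\lceil i/(b+1)\rceil$ and $\mathtt{color}(i)=((i-1)\bmod (b+1))+1$. The color order is the total order on positions $\{1,\dots,n\}$ obtained by sorting them lexicographically by the pair $(\mathtt{color}(i),\mathtt{segment}(i))$. -}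

module Defs where

open import Data.Nat using (ℕ; zero; suc; _+_; _∸_; _≤_; _<_; NonZero)
open import Data.Nat.DivMod using (_/_; _%_)
open import Data.Fin using (Fin; toℕ)
open import Data.Product using (_×_)
open import Data.Sum using (_⊎_)
open import Relation.Binary.PropositionalEquality using (_≡_)
open import Relation.Nullary using (¬_)
open import Function.Bundles using (_⤖_; Bijection)
open import Function.Base using (_∘_)

record Graph (n : ℕ) : Set₁ where
  field
    Adj   : Fin n → Fin n → Set
    sym   : ∀ {u v} → Adj u v → Adj v u
    irrefl : ∀ {u} → ¬ Adj u u

open Graph public

∣_-_∣ : ℕ → ℕ → ℕ
∣ a - b ∣ = (a ∸ b) + (b ∸ a)

-- segment(i) = ⌈ i / (b+1) ⌉ = (i + b) / (b + 1)
segment : (b i : ℕ) → ℕ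
segment b i = (i + b) / suc b

color : (b i : ℕ) → ℕ
color b i = suc ((i ∸ 1) % suc b)

_≺[_]_ : ℕ → ℕ → ℕ → Set
i ≺[ b ] j = (color b i < color b j)
           ⊎ (color b i ≡ color b j × segment b i < segment b j)

-- position of vertex v under a bijection π : Fin n → Fin n, in {1,…,n}
pos : ∀ {n} → Fin n ⤖ Fin n → Fin n → ℕ
pos π v = suc (toℕ (Bijection.to π v))

IsBOrdering : ∀ {n} → Graph n → ℕ → Fin n ⤖ Fin n → Set
IsBOrdering G b π = ∀ u v → Adj G u v → ∣ pos π u - pos π v ∣ ≤ b

-- Write a position as 1 + x with x = q·(b+1) + r and r ≤ b, so that its segment is 1 + q and its
-- color is 1 + r.  Such numbers compare lexicographically in (q, r), hence y ≤ x + b, i.e.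
-- y < r + (q+1)·(b+1), holds exactly when q_y ≤ q_x + 1 and, in case of equality, r_y < r_x.
-- Applied in both directions along every edge, this splits |π(u) − π(v)| ≤ b into (a) and (b).
module Submission where

open import Defs hiding (sym)
open import Data.Nat using (ℕ; suc; _+_; _*_; _∸_; _≤_; _<_; s≤s; s≤s⁻¹; NonZero)
open import Data.Nat.Properties
open import Data.Nat.DivMod using (_/_; _%_; m≡m%n+[m/n]*n; m%n<n; m/n≡1+[m∸n]/n)
open import Data.Fin using (Fin; toℕ)
open import Data.Product using (_×_; _,_; proj₁; proj₂)
open import Data.Product.Function.NonDependent.Propositional using (_×-⇔_)
open import Data.Sum using (_⊎_; inj₁; inj₂)
open import Function.Bundles using (_⤖_; _⇔_; mk⇔; Bijection; Equivalence)
open import Function.Construct.Composition using (_⇔-∘_)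
open import Function.Properties.Equivalence using (⇔-setoid)
open import Level using (0ℓ)
open import Relation.Binary using (tri<; tri≈; tri>)
import Relation.Binary.Reasoning.Setoid as SetoidReasoning
open import Relation.Binary.PropositionalEquality
open import Relation.Nullary using (contradiction)

m∸n≤o⇔m≤o+n : ∀ m n o → m ∸ n ≤ o ⇔ m ≤ o + n
m∸n≤o⇔m≤o+n m n o = mk⇔
  (λ m∸n≤o → subst (m ≤_) (+-comm n o) (≤-trans (m≤n+m∸n m n) (+-monoʳ-≤ n m∸n≤o)))
  (λ m≤o+n → m≤n+o⇒m∸n≤o m n (subst (m ≤_) (+-comm o n) m≤o+n))

∣-∣≤⇔∸≤ : ∀ m n o → ∣ m - n ∣ ≤ o ⇔ (m ∸ n ≤ o × n ∸ m ≤ o)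
∣-∣≤⇔∸≤ m n o = mk⇔
  (λ h → ≤-trans (m≤m+n (m ∸ n) (n ∸ m)) h , ≤-trans (m≤n+m (n ∸ m) (m ∸ n)) h)
  from
  where
  from : m ∸ n ≤ o × n ∸ m ≤ o → ∣ m - n ∣ ≤ o
  from (m∸n≤o , n∸m≤o) with ≤-total m n
  ... | inj₁ m≤n rewrite m≤n⇒m∸n≡0 m≤n = n∸m≤o
  ... | inj₂ n≤m rewrite m≤n⇒m∸n≡0 n≤m | +-identityʳ (m ∸ n) = m∸n≤o

∣-∣≤⇔ : ∀ m n o → ∣ m - n ∣ ≤ o ⇔ (m ≤ o + n × n ≤ o + m)
∣-∣≤⇔ m n o = (m∸n≤o⇔m≤o+n m n o ×-⇔ m∸n≤o⇔m≤o+n n m o) ⇔-∘ ∣-∣≤⇔∸≤ m n o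

segment-suc : ∀ b x → segment b (suc x) ≡ suc (x / suc b)
segment-suc b x = begin
  (suc x + b) / suc b             ≡⟨ m/n≡1+[m∸n]/n (s≤s (m≤n+m b x)) ⟩
  suc ((x + b ∸ b) / suc b)       ≡⟨ cong (λ y → suc (y / suc b)) (m+n∸n≡m x b) ⟩
  suc (x / suc b)                 ∎
  where open ≡-Reasoning

segment-step⇔ : ∀ b x y →
  suc (segment b (suc x)) ≡ segment b (suc y) ⇔ suc (x / suc b) ≡ y / suc b
segment-step⇔ b x y rewrite segment-suc b x | segment-suc b y = mk⇔ suc-injective (cong suc)

+*-<-lex : ∀ {m r₁ r₂} q₁ q₂ → r₁ < m → r₂ < m →
  r₁ + q₁ * m < r₂ + q₂ * m ⇔ (q₁ < q₂ ⊎ (q₁ ≡ q₂ × r₁ < r₂))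
+*-<-lex {m} {r₁} {r₂} q₁ q₂ r₁<m r₂<m = mk⇔ to (from r₁<m)
  where
  below-next : ∀ {r q q′} → r < m → q < q′ → r + q * m < q′ * m
  below-next {r} {q} {q′} r<m q<q′ = ≤-trans (+-monoˡ-< (q * m) r<m) (*-monoˡ-≤ m q<q′)
  from : ∀ {r₁ r₂ q₁ q₂} → r₁ < m → q₁ < q₂ ⊎ (q₁ ≡ q₂ × r₁ < r₂) → r₁ + q₁ * m < r₂ + q₂ * m
  from {r₂ = r₂} {q₂ = q₂} r₁<m (inj₁ q₁<q₂) = ≤-trans (below-next r₁<m q₁<q₂) (m≤n+m (q₂ * m) r₂)
  from {q₁ = q₁} _ (inj₂ (refl , r₁<r₂)) = +-monoˡ-< (q₁ * m) r₁<r₂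
  to : r₁ + q₁ * m < r₂ + q₂ * m → q₁ < q₂ ⊎ (q₁ ≡ q₂ × r₁ < r₂)
  to lt with <-cmp q₁ q₂
  ... | tri< q₁<q₂ _ _ = inj₁ q₁<q₂
  ... | tri≈ _ refl _ = inj₂ (refl , +-cancelʳ-< (q₁ * m) r₁ r₂ lt)
  ... | tri> _ _ q₂<q₁ = contradiction lt (<⇒≯ (from r₂<m (inj₁ q₂<q₁)))

<suc⊎≡suc×⇔ : ∀ {a c} {P : Set} → (a < suc c ⊎ (a ≡ suc c × P)) ⇔ (a ≤ suc c × (suc c ≡ a → P))
<suc⊎≡suc×⇔ {a} {c} {P} = mk⇔ to from
  where
  to : a < suc c ⊎ (a ≡ suc c × P) → a ≤ suc c × (suc c ≡ a → P)
  to (inj₁ a<1+c) = <⇒≤ a<1+c , λ 1+c≡a → contradiction (sym 1+c≡a) (<⇒≢ a<1+c)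
  to (inj₂ (refl , p)) = ≤-refl , λ _ → p
  from : a ≤ suc c × (suc c ≡ a → P) → a < suc c ⊎ (a ≡ suc c × P)
  from (a≤1+c , p) with m≤n⇒m<n∨m≡n a≤1+c
  ... | inj₁ a<1+c = inj₁ a<1+c
  ... | inj₂ a≡1+c = inj₂ (a≡1+c , p (sym a≡1+c))

n+m≡m%n+[1+m/n]*n : ∀ m n .{{_ : NonZero n}} → n + m ≡ m % n + suc (m / n) * n
n+m≡m%n+[1+m/n]*n m n = begin
  n + m                          ≡⟨ cong (n +_) (m≡m%n+[m/n]*n m n) ⟩
  n + (m % n + (m / n) * n)      ≡⟨ +-comm n _ ⟩
  m % n + (m / n) * n + n        ≡⟨ +-assoc (m % n) _ n ⟩
  m % n + ((m / n) * n + n)      ≡⟨ cong (m % n +_) (+-comm _ n) ⟩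
  m % n + suc (m / n) * n        ∎
  where open ≡-Reasoning

Reaches : ℕ → ℕ → ℕ → Set
Reaches b x y = y / suc b ≤ suc (x / suc b) × (suc (x / suc b) ≡ y / suc b → y % suc b < x % suc b)

≤b+⇔Reaches : ∀ b x y → y ≤ b + x ⇔ Reaches b x y
≤b+⇔Reaches b x y = begin
  y ≤ b + x                                  ≈⟨ mk⇔ s≤s s≤s⁻¹ ⟩
  y < m + x                                  ≡⟨ cong₂ _<_ (m≡m%n+[m/n]*n y m) (n+m≡m%n+[1+m/n]*n x m) ⟩
  y % m + (y / m) * m < x % m + suc (x / m) * m
    ≈⟨ +*-<-lex (y / m) (suc (x / m)) (m%n<n y m) (m%n<n x m) ⟩
  (y / m < suc (x / m) ⊎ (y / m ≡ suc (x / m) × y % m < x % m))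
    ≈⟨ <suc⊎≡suc×⇔ ⟩
  (y / m ≤ suc (x / m) × (suc (x / m) ≡ y / m → y % m < x % m)) ∎
  where
  open SetoidReasoning (⇔-setoid 0ℓ)
  m = suc b

≺⇔color< : ∀ b i j → segment b i < segment b j → j ≺[ b ] i ⇔ color b j < color b i
≺⇔color< b i j seg-i<seg-j = mk⇔ to inj₁
  where
  to : j ≺[ b ] i → color b j < color b i
  to (inj₁ colour<) = colour<
  to (inj₂ (_ , seg-j<seg-i)) = contradiction seg-j<seg-i (<-asym seg-i<seg-j)

∣-∣≤⇔Reaches : ∀ b x y → ∣ x - y ∣ ≤ b ⇔ (Reaches b y x × Reaches b x y)
∣-∣≤⇔Reaches b x y = (≤b+⇔Reaches b y x ×-⇔ ≤b+⇔Reaches b x y) ⇔-∘ ∣-∣≤⇔ x y b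

∣segment-segment∣≤1⇔ : ∀ b x y → ∣ segment b (suc x) - segment b (suc y) ∣ ≤ 1 ⇔
  (x / suc b ≤ suc (y / suc b) × y / suc b ≤ suc (x / suc b))
∣segment-segment∣≤1⇔ b x y rewrite segment-suc b x | segment-suc b y = ∣-∣≤⇔ (x / suc b) (y / suc b) 1

segment-step⇒≺⇔ : ∀ b x y →
  (suc (segment b (suc x)) ≡ segment b (suc y) → suc y ≺[ b ] suc x)
    ⇔ (suc (x / suc b) ≡ y / suc b → y % suc b < x % suc b)
segment-step⇒≺⇔ b x y = mk⇔
  (λ h e → let step = Equivalence.from (segment-step⇔ b x y) e in
    s≤s⁻¹ (Equivalence.to (≺⇔color< b (suc x) (suc y) (≤-reflexive step)) (h step)))
  (λ h step → Equivalence.from (≺⇔color< b (suc x) (suc y) (≤-reflexive step))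
    (s≤s (h (Equivalence.to (segment-step⇔ b x y) step))))

corollary1 : (n : ℕ) (G : Graph n) (b : ℕ) → 1 ≤ b → b < n →
    (π : Fin n ⤖ Fin n) →
    IsBOrdering G b π ⇔
      ((∀ u v → Adj G u v →
          suc (segment b (pos π u)) ≡ segment b (pos π v) →
          pos π v ≺[ b ] pos π u)
       × (∀ u v → Adj G u v →
          ∣ segment b (pos π u) - segment b (pos π v) ∣ ≤ 1))
-- The equivalence holds for every b.
corollary1 n G b _ _ π = mk⇔ to from
  where
  -- pos π u is suc (x u), and ∣ suc a - suc c ∣ reduces to ∣ a - c ∣.
  x : Fin n → ℕ
  x u = toℕ (Bijection.to π u)

  ColourCondition SegmentCondition : Set
  ColourCondition = ∀ u v → Adj G u v →
    suc (segment b (pos π u)) ≡ segment b (pos π v) → pos π v ≺[ b ] pos π u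
  SegmentCondition = ∀ u v → Adj G u v → ∣ segment b (pos π u) - segment b (pos π v) ∣ ≤ 1

  to : IsBOrdering G b π → ColourCondition × SegmentCondition
  to ordered =
      (λ u v uv → Equivalence.from (segment-step⇒≺⇔ b (x u) (x v)) (proj₂ (reaches u v uv)))
    , (λ u v uv → Equivalence.from (∣segment-segment∣≤1⇔ b (x u) (x v))
                    (proj₁ (reaches v u (Graph.sym G uv)) , proj₁ (reaches u v uv)))
    where
    reaches : ∀ u v → Adj G u v → Reaches b (x u) (x v)
    reaches u v uv = proj₂ (Equivalence.to (∣-∣≤⇔Reaches b (x u) (x v)) (ordered u v uv))

  from : ColourCondition × SegmentCondition → IsBOrdering G b π
  from (colour-steps , segments-close) u v uv = Equivalence.from (∣-∣≤⇔Reaches b (x u) (x v))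
    ( (proj₁ close , Equivalence.to (segment-step⇒≺⇔ b (x v) (x u))
                                    (colour-steps v u (Graph.sym G uv)))
    , (proj₂ close , Equivalence.to (segment-step⇒≺⇔ b (x u) (x v)) (colour-steps u v uv)))
    where
    close : x u / suc b ≤ suc (x v / suc b) × x v / suc b ≤ suc (x u / suc b)
    close = Equivalence.to (∣segment-segment∣≤1⇔ b (x u) (x v)) (segments-close u v uv)
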